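{- For $n\in{\mathbb N}$ let $j(n):=\frac13(-2)^n-\frac12(-1)^n+\frac16$, and let $G(n)=\{(-2)^i\mid 0\leq i<n\}$. Then the map $\sigma$ from the set of subsets of $G(n)$ to ${\mathbb Z}$, $\sigma(Z):=\sum_{g\in Z}g$, is a bijection onto the integer interval $\Delta(n):=[j(k),\,j(k)+2^n-1]\cap{\mathbb Z}$, where $k=k(n):=2E(n/2)+1$ and $E(x)$ denotes the integral part of $x$. -}

module Defs where

open import Data.Nat as ℕ using (ℕ)
open import Data.Integer as ℤ using (ℤ; +_; -_)
open import Data.Rational as ℚ using (ℚ)
open import Data.Fin using (Fin; toℕ)
open import Data.Fin.Subset using (Subset)
open import Data.Vec using (Vec; lookup; tabulate; foldr′)
open import Data.Bool using (if_then_else_)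
open import Data.Product using (_×_; Σ-syntax)
open import Relation.Binary.PropositionalEquality using (_≡_)
open import Function.Definitions using (Injective)

j : ℕ → ℚ
j n = ((- + 2) ℤ.^ n) ℚ./ 3 ℚ.- ((- + 1) ℤ.^ n) ℚ./ 2 ℚ.+ (+ 1) ℚ./ 6

k : ℕ → ℕ
k n = 2 ℕ.* (n ℕ./ 2) ℕ.+ 1

-- G(n) = {(-2)^i | 0 ≤ i < n}; its elements are pairwise distinct, so a
-- subset Z of G(n) is given by the set of exponents i ∈ Fin n with (-2)^i ∈ Z.
g : ℕ → ℤ
g i = (- + 2) ℤ.^ i

σ : ∀ {n} → Subset n → ℤ
σ {n} Z = foldr′ ℤ._+_ (+ 0) (tabulate λ i → if lookup Z i then g (toℕ i) else + 0)

⟦_⟧ : ℤ → ℚ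
⟦ z ⟧ = z ℚ./ 1

InΔ : ℕ → ℤ → Set
InΔ n z = (j (k n) ℚ.≤ ⟦ z ⟧) × (⟦ z ⟧ ℚ.≤ j (k n) ℚ.+ ⟦ + (2 ℕ.^ n) ⟧ ℚ.- ⟦ + 1 ⟧)

σ-BijectionOntoΔ : ℕ → Set
σ-BijectionOntoΔ n =
  (∀ (Z : Subset n) → InΔ n (σ Z))
  × Injective _≡_ _≡_ (σ {n})
  × (∀ (z : ℤ) → InΔ n z → Σ[ Z ∈ Subset n ] σ Z ≡ z)

module Submission where

open import Defs
open import Data.Bool using (Bool; true; false; not; if_then_else_)
open import Data.Bool.Properties using (not-injective; not-involutive; if-float)
open import Data.Empty using (⊥-elim)
open import Data.Fin using (Fin; toℕ)
import Data.Fin as Fin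
open import Data.Fin.Subset using (Subset)
open import Data.Integer as ℤ using (ℤ; +_; -_)
import Data.Integer.Properties as ℤP
open import Algebra.Properties.AbelianGroup ℤP.+-0-abelianGroup using (∙-cancelˡ)
open import Data.Integer.Tactic.RingSolver using (solve-∀)
open import Data.Nat as ℕ using (ℕ; zero; suc; _<_; s≤s)
open import Data.Nat.DivMod using (m/n≡1+[m∸n]/n)
import Data.Nat.Properties as ℕP
import Data.Nat.Tactic.RingSolver as ℕ-Solver
open import Data.Product using (_×_; _,_; ∃; ∃₂; Σ-syntax)
open import Data.Rational as ℚ using (toℚᵘ)
open import Data.Rational.Properties
  using (toℚᵘ-fromℚᵘ; toℚᵘ-injective; toℚᵘ-mono-≤; toℚᵘ-cancel-≤; toℚᵘ-homo-+; toℚᵘ-homo‿-)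
open import Data.Rational.Unnormalised as ℚᵘ using (mkℚᵘ; *≡*; *≤*)
import Data.Rational.Unnormalised.Properties as ℚᵘP
open import Data.Vec using ([]; _∷_; lookup; tabulate; foldr′)
open import Data.Vec.Properties using (tabulate-cong)
open import Function.Bundles using (_⇔_; mk⇔; Equivalence)
open import Function.Definitions using (Injective)
open import Relation.Binary.PropositionalEquality

-- Since σ (b ∷ Z) = b - 2 σ Z, the extreme values of σ on subsets of G(n) satisfy
-- minσ (n+1) = -2 maxσ n and maxσ (n+1) = 1 - 2 minσ n (the minimum takes the
-- negative powers, the maximum the positive ones), and the offsets σ Z - minσ n
-- and maxσ n - σ Z obey the mutual recursions  above (b ∷ Z) = b + 2 below Z,
-- below (b ∷ Z) = (1 - b) + 2 above Z.  These are binary expansions, hence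
-- bijections from subsets onto [0, 2ⁿ); so σ is a bijection onto
-- [minσ n, minσ n + 2ⁿ - 1].  Finally 3 minσ n = (-2)^k(n) + 2 with k(n) odd,
-- which is exactly j(k(n)).

bit : Bool → ℕ
bit false = 0
bit true  = 1

bit+2*-injective : ∀ b c {x y} → bit b ℕ.+ 2 ℕ.* x ≡ bit c ℕ.+ 2 ℕ.* y → b ≡ c × x ≡ y
bit+2*-injective false false {x} {y} eq = refl , ℕP.*-cancelˡ-≡ x y 2 eq
bit+2*-injective true  true  {x} {y} eq = refl , ℕP.*-cancelˡ-≡ x y 2 (ℕP.suc-injective eq)
bit+2*-injective false true  {x} {y} eq = ⊥-elim (ℕP.even≢odd x y eq)
bit+2*-injective true  false {x} {y} eq = ⊥-elim (ℕP.even≢odd y x (sym eq))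

bit+2*-surjective : ∀ t → ∃₂ λ b q → bit b ℕ.+ 2 ℕ.* q ≡ t
bit+2*-surjective zero          = false , 0 , refl
bit+2*-surjective (suc zero)    = true , 0 , refl
bit+2*-surjective (suc (suc t)) with bit+2*-surjective t
... | b , q , refl = b , suc q , shift (bit b) q
  where
  shift : ∀ x q → x ℕ.+ 2 ℕ.* suc q ≡ 2 ℕ.+ (x ℕ.+ 2 ℕ.* q)
  shift = ℕ-Solver.solve-∀

bit+2*q<2*m⇒q<m : ∀ b q {m} → bit b ℕ.+ 2 ℕ.* q < 2 ℕ.* m → q < m
bit+2*q<2*m⇒q<m b q lt = ℕP.*-cancelˡ-< 2 _ _ (ℕP.≤-<-trans (ℕP.m≤n+m (2 ℕ.* q) (bit b)) lt)

above below : ∀ {n} → Subset n → ℕ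
above []      = 0
above (b ∷ Z) = bit b ℕ.+ 2 ℕ.* below Z
below []      = 0
below (b ∷ Z) = bit (not b) ℕ.+ 2 ℕ.* above Z

above-injective : ∀ {n} {Z Z′ : Subset n} → above Z ≡ above Z′ → Z ≡ Z′
below-injective : ∀ {n} {Z Z′ : Subset n} → below Z ≡ below Z′ → Z ≡ Z′
above-injective {Z = []}    {[]}      _  = refl
above-injective {Z = b ∷ Z} {c ∷ Z′} eq with bit+2*-injective b c eq
... | refl , eq′ = cong (b ∷_) (below-injective eq′)
below-injective {Z = []}    {[]}      _  = refl
below-injective {Z = b ∷ Z} {c ∷ Z′} eq with bit+2*-injective (not b) (not c) eq
... | b≡c , eq′ rewrite not-injective b≡c = cong (c ∷_) (above-injective eq′)

above-surjective : ∀ n {t} → t < 2 ℕ.^ n → ∃ λ (Z : Subset n) → above Z ≡ t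
below-surjective : ∀ n {t} → t < 2 ℕ.^ n → ∃ λ (Z : Subset n) → below Z ≡ t
above-surjective zero    {zero} _ = [] , refl
above-surjective zero    {suc t} (s≤s ())
above-surjective (suc n) {t}    lt with bit+2*-surjective t
... | b , q , refl with below-surjective n (bit+2*q<2*m⇒q<m b q lt)
... | Z , refl = b ∷ Z , refl
below-surjective zero    {zero} _ = [] , refl
below-surjective zero    {suc t} (s≤s ())
below-surjective (suc n) {t}    lt with bit+2*-surjective t
... | b , q , refl with above-surjective n (bit+2*q<2*m⇒q<m b q lt)
... | Z , refl = not b ∷ Z , cong (λ c → bit c ℕ.+ 2 ℕ.* above Z) (not-involutive b)

sum-tabulate-*ˡ : ∀ {n} c (f : Fin n → ℤ) →
  foldr′ ℤ._+_ (+ 0) (tabulate (λ i → c ℤ.* f i)) ≡ c ℤ.* foldr′ ℤ._+_ (+ 0) (tabulate f)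
sum-tabulate-*ˡ {zero}  c f = sym (ℤP.*-zeroʳ c)
sum-tabulate-*ˡ {suc n} c f = begin
  c ℤ.* f Fin.zero ℤ.+ foldr′ ℤ._+_ (+ 0) (tabulate (λ i → c ℤ.* f (Fin.suc i)))
    ≡⟨ cong (ℤ._+_ (c ℤ.* f Fin.zero)) (sum-tabulate-*ˡ c (λ i → f (Fin.suc i))) ⟩
  c ℤ.* f Fin.zero ℤ.+ c ℤ.* foldr′ ℤ._+_ (+ 0) (tabulate (λ i → f (Fin.suc i)))
    ≡⟨ ℤP.*-distribˡ-+ c _ _ ⟨
  c ℤ.* foldr′ ℤ._+_ (+ 0) (tabulate f) ∎
  where open ≡-Reasoning

σ-∷ : ∀ {n} b (Z : Subset n) → σ (b ∷ Z) ≡ + bit b ℤ.+ - + 2 ℤ.* σ Z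
σ-∷ b Z = cong₂ ℤ._+_ (head b) (begin
  foldr′ ℤ._+_ (+ 0) (tabulate (λ i → if lookup Z i then g (suc (toℕ i)) else + 0))
    ≡⟨ cong (foldr′ ℤ._+_ (+ 0)) (tabulate-cong (λ i → sym (if-float (- + 2 ℤ.*_) (lookup Z i)))) ⟩
  foldr′ ℤ._+_ (+ 0) (tabulate (λ i → - + 2 ℤ.* (if lookup Z i then g (toℕ i) else + 0)))
    ≡⟨ sum-tabulate-*ˡ (- + 2) (λ i → if lookup Z i then g (toℕ i) else + 0) ⟩
  - + 2 ℤ.* σ Z ∎)
  where
  open ≡-Reasoning
  head : ∀ b → (if b then + 1 else + 0) ≡ + bit b
  head false = refl
  head true  = refl

minσ maxσ : ℕ → ℤ
minσ zero    = + 0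
minσ (suc n) = - + 2 ℤ.* maxσ n
maxσ zero    = + 0
maxσ (suc n) = + 1 ℤ.- + 2 ℤ.* minσ n

+bit+2* : ∀ b x → + (bit b ℕ.+ 2 ℕ.* x) ≡ + bit b ℤ.+ + 2 ℤ.* + x
+bit+2* b x = trans (ℤP.pos-+ (bit b) (2 ℕ.* x)) (cong (ℤ._+_ (+ bit b)) (ℤP.pos-* 2 x))

σ≡minσ+above : ∀ {n} (Z : Subset n) → σ Z ≡ minσ n ℤ.+ + above Z
σ≡maxσ-below : ∀ {n} (Z : Subset n) → σ Z ≡ maxσ n ℤ.- + below Z
σ≡minσ+above []            = refl
σ≡minσ+above {suc n} (b ∷ Z) = begin
  σ (b ∷ Z)                                         ≡⟨ σ-∷ b Z ⟩
  + bit b ℤ.+ - + 2 ℤ.* σ Z                         ≡⟨ cong (λ s → + bit b ℤ.+ - + 2 ℤ.* s) (σ≡maxσ-below Z) ⟩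
  + bit b ℤ.+ - + 2 ℤ.* (maxσ n ℤ.- + below Z)      ≡⟨ regroup (+ bit b) (maxσ n) (+ below Z) ⟩
  minσ (suc n) ℤ.+ (+ bit b ℤ.+ + 2 ℤ.* + below Z)  ≡⟨ cong (ℤ._+_ (minσ (suc n))) (+bit+2* b (below Z)) ⟨
  minσ (suc n) ℤ.+ + above (b ∷ Z)                  ∎
  where
  open ≡-Reasoning
  regroup : ∀ x M y → x ℤ.+ - + 2 ℤ.* (M ℤ.- y) ≡ - + 2 ℤ.* M ℤ.+ (x ℤ.+ + 2 ℤ.* y)
  regroup = solve-∀
σ≡maxσ-below []            = refl
σ≡maxσ-below {suc n} (b ∷ Z) = begin
  σ (b ∷ Z)                                                ≡⟨ σ-∷ b Z ⟩
  + bit b ℤ.+ - + 2 ℤ.* σ Z                                ≡⟨ cong (λ s → + bit b ℤ.+ - + 2 ℤ.* s) (σ≡minσ+above Z) ⟩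
  + bit b ℤ.+ - + 2 ℤ.* (minσ n ℤ.+ + above Z)             ≡⟨ regroup b (minσ n) (+ above Z) ⟩
  maxσ (suc n) ℤ.- (+ bit (not b) ℤ.+ + 2 ℤ.* + above Z)   ≡⟨ cong (ℤ._-_ (maxσ (suc n))) (+bit+2* (not b) (above Z)) ⟨
  maxσ (suc n) ℤ.- + below (b ∷ Z)                         ∎
  where
  open ≡-Reasoning
  regroup : ∀ b M y → + bit b ℤ.+ - + 2 ℤ.* (M ℤ.+ y) ≡ + 1 ℤ.- + 2 ℤ.* M ℤ.- (+ bit (not b) ℤ.+ + 2 ℤ.* y)
  regroup false = solve-∀
  regroup true  = solve-∀

maxσ≡minσ+2^n-1 : ∀ n → maxσ n ≡ minσ n ℤ.+ + (2 ℕ.^ n) ℤ.- + 1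
maxσ≡minσ+2^n-1 zero    = refl
maxσ≡minσ+2^n-1 (suc n) = begin
  + 1 ℤ.- + 2 ℤ.* minσ n                                          ≡⟨ step (minσ n) (+ (2 ℕ.^ n)) ⟩
  - + 2 ℤ.* (minσ n ℤ.+ + (2 ℕ.^ n) ℤ.- + 1) ℤ.+ + 2 ℤ.* + (2 ℕ.^ n) ℤ.- + 1
    ≡⟨ cong₂ (λ M P → - + 2 ℤ.* M ℤ.+ P ℤ.- + 1) (maxσ≡minσ+2^n-1 n) (ℤP.pos-* 2 (2 ℕ.^ n)) ⟨
  - + 2 ℤ.* maxσ n ℤ.+ + (2 ℕ.^ suc n) ℤ.- + 1                    ∎
  where
  open ≡-Reasoning
  step : ∀ M P → + 1 ℤ.- + 2 ℤ.* M ≡ - + 2 ℤ.* (M ℤ.+ P ℤ.- + 1) ℤ.+ + 2 ℤ.* P ℤ.- + 1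
  step = solve-∀

k-suc-suc : ∀ n → k (suc (suc n)) ≡ suc (suc (k n))
k-suc-suc n = begin
  2 ℕ.* (suc (suc n) ℕ./ 2) ℕ.+ 1 ≡⟨ cong (λ q → 2 ℕ.* q ℕ.+ 1) (m/n≡1+[m∸n]/n {suc (suc n)} {2} (ℕ.s≤s (ℕ.s≤s ℕ.z≤n))) ⟩
  2 ℕ.* suc (n ℕ./ 2) ℕ.+ 1         ≡⟨ shift (n ℕ./ 2) ⟩
  suc (suc (k n))                   ∎
  where
  open ≡-Reasoning
  shift : ∀ q → 2 ℕ.* suc q ℕ.+ 1 ≡ suc (suc (2 ℕ.* q ℕ.+ 1))
  shift = ℕ-Solver.solve-∀

3*minσ≡g∘k+2 : ∀ n → + 3 ℤ.* minσ n ≡ g (k n) ℤ.+ + 2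
3*minσ≡g∘k+2 zero          = refl
3*minσ≡g∘k+2 (suc zero)    = refl
3*minσ≡g∘k+2 (suc (suc n)) = begin
  + 3 ℤ.* (- + 2 ℤ.* (+ 1 ℤ.- + 2 ℤ.* minσ n))   ≡⟨ lhs (minσ n) ⟩
  + 4 ℤ.* (+ 3 ℤ.* minσ n) ℤ.- + 6               ≡⟨ cong (λ x → + 4 ℤ.* x ℤ.- + 6) (3*minσ≡g∘k+2 n) ⟩
  + 4 ℤ.* (g (k n) ℤ.+ + 2) ℤ.- + 6              ≡⟨ rhs (g (k n)) ⟩
  g (suc (suc (k n))) ℤ.+ + 2                     ≡⟨ cong (λ t → g t ℤ.+ + 2) (k-suc-suc n) ⟨
  g (k (suc (suc n))) ℤ.+ + 2                     ∎
  where
  open ≡-Reasoning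
  lhs : ∀ M → + 3 ℤ.* (- + 2 ℤ.* (+ 1 ℤ.- + 2 ℤ.* M)) ≡ + 4 ℤ.* (+ 3 ℤ.* M) ℤ.- + 6
  lhs = solve-∀
  rhs : ∀ G → + 4 ℤ.* (G ℤ.+ + 2) ℤ.- + 6 ≡ - + 2 ℤ.* (- + 2 ℤ.* G) ℤ.+ + 2
  rhs = solve-∀

toℚᵘ-/ : ∀ i d → toℚᵘ (i ℚ./ suc d) ℚᵘ.≃ mkℚᵘ i d
toℚᵘ-/ i d = toℚᵘ-fromℚᵘ (mkℚᵘ i d)

toℚᵘ-homo-− : ∀ p q → toℚᵘ (p ℚ.- q) ℚᵘ.≃ toℚᵘ p ℚᵘ.- toℚᵘ q
toℚᵘ-homo-− p q = ℚᵘP.≃-trans (toℚᵘ-homo-+ p (ℚ.- q)) (ℚᵘP.+-congʳ (toℚᵘ p) (toℚᵘ-homo‿- q))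

⟦⟧-mono-≤ : ∀ {a b} → a ℤ.≤ b → ⟦ a ⟧ ℚ.≤ ⟦ b ⟧
⟦⟧-mono-≤ {a} {b} a≤b = toℚᵘ-cancel-≤
  (ℚᵘP.≤-respˡ-≃ (ℚᵘP.≃-sym (toℚᵘ-/ a 0)) (ℚᵘP.≤-respʳ-≃ (ℚᵘP.≃-sym (toℚᵘ-/ b 0))
    (*≤* (ℤP.*-monoʳ-≤-nonNeg (+ 1) a≤b))))

⟦⟧-cancel-≤ : ∀ {a b} → ⟦ a ⟧ ℚ.≤ ⟦ b ⟧ → a ℤ.≤ b
⟦⟧-cancel-≤ {a} {b} le with ℚᵘP.≤-respˡ-≃ (toℚᵘ-/ a 0) (ℚᵘP.≤-respʳ-≃ (toℚᵘ-/ b 0) (toℚᵘ-mono-≤ le))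
... | *≤* a*1≤b*1 = ℤP.*-cancelʳ-≤-pos a b (+ 1) a*1≤b*1

⟦⟧-homo-+ : ∀ a b → ⟦ a ℤ.+ b ⟧ ≡ ⟦ a ⟧ ℚ.+ ⟦ b ⟧
⟦⟧-homo-+ a b = toℚᵘ-injective (begin
  toℚᵘ ⟦ a ℤ.+ b ⟧                  ≈⟨ toℚᵘ-/ (a ℤ.+ b) 0 ⟩
  mkℚᵘ (a ℤ.+ b) 0                  ≈⟨ *≡* (cross a b) ⟩
  mkℚᵘ a 0 ℚᵘ.+ mkℚᵘ b 0            ≈⟨ ℚᵘP.+-cong (toℚᵘ-/ a 0) (toℚᵘ-/ b 0) ⟨
  toℚᵘ ⟦ a ⟧ ℚᵘ.+ toℚᵘ ⟦ b ⟧        ≈⟨ toℚᵘ-homo-+ ⟦ a ⟧ ⟦ b ⟧ ⟨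
  toℚᵘ (⟦ a ⟧ ℚ.+ ⟦ b ⟧)            ∎)
  where
  open ℚᵘP.≃-Reasoning
  cross : ∀ a b → (a ℤ.+ b) ℤ.* + 1 ≡ (a ℤ.* + 1 ℤ.+ b ℤ.* + 1) ℤ.* + 1
  cross = solve-∀

⟦⟧-homo-− : ∀ a b → ⟦ a ℤ.- b ⟧ ≡ ⟦ a ⟧ ℚ.- ⟦ b ⟧
⟦⟧-homo-− a b = toℚᵘ-injective (begin
  toℚᵘ ⟦ a ℤ.- b ⟧                  ≈⟨ toℚᵘ-/ (a ℤ.- b) 0 ⟩
  mkℚᵘ (a ℤ.- b) 0                  ≈⟨ *≡* (cross a b) ⟩
  mkℚᵘ a 0 ℚᵘ.- mkℚᵘ b 0            ≈⟨ ℚᵘP.+-cong (toℚᵘ-/ a 0) (ℚᵘP.-‿cong (toℚᵘ-/ b 0)) ⟨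
  toℚᵘ ⟦ a ⟧ ℚᵘ.- toℚᵘ ⟦ b ⟧        ≈⟨ toℚᵘ-homo-− ⟦ a ⟧ ⟦ b ⟧ ⟨
  toℚᵘ (⟦ a ⟧ ℚ.- ⟦ b ⟧)            ∎)
  where
  open ℚᵘP.≃-Reasoning
  cross : ∀ a b → (a ℤ.- b) ℤ.* + 1 ≡ (a ℤ.* + 1 ℤ.+ (- b) ℤ.* + 1) ℤ.* + 1
  cross = solve-∀

-1^[2q+1]≡-1 : ∀ q → (- + 1) ℤ.^ (2 ℕ.* q ℕ.+ 1) ≡ - + 1
-1^[2q+1]≡-1 q = begin
  (- + 1) ℤ.^ (2 ℕ.* q ℕ.+ 1)          ≡⟨ ℤP.^-distribˡ-+-* (- + 1) (2 ℕ.* q) 1 ⟩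
  (- + 1) ℤ.^ (2 ℕ.* q) ℤ.* (- + 1)    ≡⟨ cong (ℤ._* (- + 1)) (ℤP.^-*-assoc (- + 1) 2 q) ⟨
  (+ 1) ℤ.^ q ℤ.* (- + 1)              ≡⟨ cong (ℤ._* (- + 1)) (ℤP.^-zeroˡ q) ⟩
  - + 1                                ∎
  where open ≡-Reasoning

j≡⟦⟧ : ∀ t M → (- + 1) ℤ.^ t ≡ - + 1 → + 3 ℤ.* M ≡ g t ℤ.+ + 2 → j t ≡ ⟦ M ⟧
j≡⟦⟧ t M -1^t≡-1 3M≡gt+2 = trans (cong (λ s → g t ℚ./ 3 ℚ.- s ℚ./ 2 ℚ.+ + 1 ℚ./ 6) -1^t≡-1)
  (toℚᵘ-injective (begin
    toℚᵘ (g t ℚ./ 3 ℚ.- (- + 1) ℚ./ 2 ℚ.+ + 1 ℚ./ 6)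
      ≈⟨ toℚᵘ-homo-+ (g t ℚ./ 3 ℚ.- (- + 1) ℚ./ 2) (+ 1 ℚ./ 6) ⟩
    toℚᵘ (g t ℚ./ 3 ℚ.- (- + 1) ℚ./ 2) ℚᵘ.+ toℚᵘ (+ 1 ℚ./ 6)
      ≈⟨ ℚᵘP.+-congˡ (toℚᵘ (+ 1 ℚ./ 6)) (toℚᵘ-homo-− (g t ℚ./ 3) ((- + 1) ℚ./ 2)) ⟩
    toℚᵘ (g t ℚ./ 3) ℚᵘ.- toℚᵘ ((- + 1) ℚ./ 2) ℚᵘ.+ toℚᵘ (+ 1 ℚ./ 6)
      ≈⟨ ℚᵘP.+-cong (ℚᵘP.+-cong (toℚᵘ-/ (g t) 2) (ℚᵘP.-‿cong (toℚᵘ-/ (- + 1) 1))) (toℚᵘ-/ (+ 1) 5) ⟩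
    mkℚᵘ (g t) 2 ℚᵘ.- mkℚᵘ (- + 1) 1 ℚᵘ.+ mkℚᵘ (+ 1) 5
      ≈⟨ *≡* cross ⟩
    mkℚᵘ M 0
      ≈⟨ toℚᵘ-/ M 0 ⟨
    toℚᵘ ⟦ M ⟧ ∎))
  where
  open ℚᵘP.≃-Reasoning
  -- the equation of cross-multiplied numerators that *≡* asks for, in the shape ℚᵘ._+_ produces
  cross : ((g t ℤ.* + 2 ℤ.+ (- (- + 1)) ℤ.* + 3) ℤ.* + 6 ℤ.+ + 1 ℤ.* + 6) ℤ.* + 1 ≡ M ℤ.* + 36
  cross = trans (expand (g t)) (trans (cong (+ 12 ℤ.*_) (sym 3M≡gt+2)) (collect M))
    where
    expand : ∀ A → ((A ℤ.* + 2 ℤ.+ (- (- + 1)) ℤ.* + 3) ℤ.* + 6 ℤ.+ + 1 ℤ.* + 6) ℤ.* + 1 ≡ + 12 ℤ.* (A ℤ.+ + 2)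
    expand = solve-∀
    collect : ∀ M → + 12 ℤ.* (+ 3 ℤ.* M) ≡ M ℤ.* + 36
    collect = solve-∀

j∘k≡⟦minσ⟧ : ∀ n → j (k n) ≡ ⟦ minσ n ⟧
j∘k≡⟦minσ⟧ n = j≡⟦⟧ (k n) (minσ n) (-1^[2q+1]≡-1 (n ℕ./ 2)) (3*minσ≡g∘k+2 n)

Δ-top≡⟦maxσ⟧ : ∀ n → j (k n) ℚ.+ ⟦ + (2 ℕ.^ n) ⟧ ℚ.- ⟦ + 1 ⟧ ≡ ⟦ maxσ n ⟧
Δ-top≡⟦maxσ⟧ n = begin
  j (k n) ℚ.+ ⟦ + (2 ℕ.^ n) ⟧ ℚ.- ⟦ + 1 ⟧      ≡⟨ cong (λ q → q ℚ.+ ⟦ + (2 ℕ.^ n) ⟧ ℚ.- ⟦ + 1 ⟧) (j∘k≡⟦minσ⟧ n) ⟩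
  ⟦ minσ n ⟧ ℚ.+ ⟦ + (2 ℕ.^ n) ⟧ ℚ.- ⟦ + 1 ⟧   ≡⟨ cong (ℚ._- ⟦ + 1 ⟧) (⟦⟧-homo-+ (minσ n) (+ (2 ℕ.^ n))) ⟨
  ⟦ minσ n ℤ.+ + (2 ℕ.^ n) ⟧ ℚ.- ⟦ + 1 ⟧       ≡⟨ ⟦⟧-homo-− (minσ n ℤ.+ + (2 ℕ.^ n)) (+ 1) ⟨
  ⟦ minσ n ℤ.+ + (2 ℕ.^ n) ℤ.- + 1 ⟧           ≡⟨ cong ⟦_⟧ (maxσ≡minσ+2^n-1 n) ⟨
  ⟦ maxσ n ⟧                                    ∎
  where open ≡-Reasoning

InΔ⇔ : ∀ n z → InΔ n z ⇔ (minσ n ℤ.≤ z × z ℤ.≤ maxσ n)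
InΔ⇔ n z = mk⇔
  (λ (lo , hi) → ⟦⟧-cancel-≤ (subst (ℚ._≤ ⟦ z ⟧) (j∘k≡⟦minσ⟧ n) lo)
               , ⟦⟧-cancel-≤ (subst (⟦ z ⟧ ℚ.≤_) (Δ-top≡⟦maxσ⟧ n) hi))
  (λ (lo , hi) → subst (ℚ._≤ ⟦ z ⟧) (sym (j∘k≡⟦minσ⟧ n)) (⟦⟧-mono-≤ lo)
               , subst (⟦ z ⟧ ℚ.≤_) (sym (Δ-top≡⟦maxσ⟧ n)) (⟦⟧-mono-≤ hi))

minσ≤σ≤maxσ : ∀ {n} (Z : Subset n) → minσ n ℤ.≤ σ Z × σ Z ℤ.≤ maxσ n
minσ≤σ≤maxσ {n} Z =
    subst (minσ n ℤ.≤_) (sym (σ≡minσ+above Z)) (ℤP.i≤i+j (minσ n) (+ above Z))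
  , subst (ℤ._≤ maxσ n) (sym (σ≡maxσ-below Z)) (ℤP.i-j≤i (maxσ n) (+ below Z))

σ-injective : ∀ n → Injective _≡_ _≡_ (σ {n})
σ-injective n {Z} {Z′} σZ≡σZ′ = above-injective (ℤP.+-injective (∙-cancelˡ (minσ n) _ _
  (trans (sym (σ≡minσ+above Z)) (trans σZ≡σZ′ (σ≡minσ+above Z′)))))

minσ≤z≤maxσ⇒z≡minσ+t : ∀ n {z} → minσ n ℤ.≤ z → z ℤ.≤ maxσ n →
                        Σ[ t ∈ ℕ ] t ℕ.< 2 ℕ.^ n × z ≡ minσ n ℤ.+ + t
minσ≤z≤maxσ⇒z≡minσ+t n {z} lo hi = t , t<2^n , sym (trans (cong (ℤ._+_ (minσ n)) +t≡z-minσ) (cancel (minσ n) z))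
  where
  t : ℕ
  t = ℤ.∣ z ℤ.- minσ n ∣
  +t≡z-minσ : + t ≡ z ℤ.- minσ n
  +t≡z-minσ = ℤP.0≤i⇒+∣i∣≡i (ℤP.i≤j⇒0≤j-i lo)
  cancel : ∀ M z → M ℤ.+ (z ℤ.- M) ≡ z
  cancel = solve-∀
  width : ∀ M P → M ℤ.+ P ℤ.- + 1 ℤ.- M ≡ - + 1 ℤ.+ P
  width = solve-∀
  open ℤP.≤-Reasoning
  t<2^n : t ℕ.< 2 ℕ.^ n
  t<2^n = ℤP.drop‿+<+ (ℤP.i≤pred[j]⇒i<j (begin
    + t                                              ≡⟨ +t≡z-minσ ⟩
    z ℤ.- minσ n                                     ≤⟨ ℤP.+-monoˡ-≤ (- minσ n) hi ⟩
    maxσ n ℤ.- minσ n                                ≡⟨ cong (ℤ._- minσ n) (maxσ≡minσ+2^n-1 n) ⟩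
    minσ n ℤ.+ + (2 ℕ.^ n) ℤ.- + 1 ℤ.- minσ n        ≡⟨ width (minσ n) (+ (2 ℕ.^ n)) ⟩
    ℤ.pred (+ (2 ℕ.^ n))                             ∎))

σ-surjective : ∀ n {z} → minσ n ℤ.≤ z → z ℤ.≤ maxσ n → Σ[ Z ∈ Subset n ] σ Z ≡ z
σ-surjective n lo hi with minσ≤z≤maxσ⇒z≡minσ+t n lo hi
... | t , t<2^n , refl with above-surjective n t<2^n
... | Z , refl = Z , σ≡minσ+above Z

lemma4p1 : (n : ℕ) → σ-BijectionOntoΔ n
lemma4p1 n =
    (λ Z → Equivalence.from (InΔ⇔ n (σ Z)) (minσ≤σ≤maxσ Z))
  , σ-injective n
  , λ z z∈Δ → let (lo , hi) = Equivalence.to (InΔ⇔ n z) z∈Δ in σ-surjective n lo hi
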